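{- Let $\mathbb{F}_2^{n-1}$ be identified with a hyperplane (an $(n-1)$-dimensional linear subspace) of $\mathbb{F}_2^n$, let $e_0\in\mathbb{F}_2^n\setminus\mathbb{F}_2^{n-1}$, and let $f,g\colon\mathbb{F}_2^{n-1}\to\mathbb{F}_2^m$ be functions. Define $F\colon\mathbb{F}_2^n\to\mathbb{F}_2^m$ by $F(x):=f(x)$ and $F(x+e_0):=g(x)$ for $x\in\mathbb{F}_2^{n-1}$. Then $F$ is APN if and only if both of the following hold: (1) $f$ and $g$ are APN functions from $\mathbb{F}_2^{n-1}$ to $\mathbb{F}_2^m$; (2) $f(x+a)+f(x)+g(y+a)+g(y)\neq 0$ for all $x,y\in\mathbb{F}_2^{n-1}$ and all nonzero $a\in\mathbb{F}_2^{n-1}$.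
   Context: A function $F\colon\mathbb{F}_2^k\to\mathbb{F}_2^m$ is APN if for every nonzero $a\in\mathbb{F}_2^k$ and every $b\in\mathbb{F}_2^m$ the set $\{x\in\mathbb{F}_2^k: F(x+a)+F(x)=b\}$ has at most $2$ elements. Note $\mathbb{F}_2^n=\mathbb{F}_2^{n-1}\cup(\mathbb{F}_2^{n-1}+e_0)$, so $F$ is well defined on all of $\mathbb{F}_2^n$. -}

module Defs where

open import Data.Bool using (Bool; false; true; _xor_)
open import Data.Nat using (ℕ)
open import Data.Vec using (Vec; zipWith; replicate)
open import Data.Sum using (_⊎_)
open import Relation.Binary.PropositionalEquality using (_≡_; _≢_)
open import Relation.Nullary using (¬_)
open import Data.Product using (∃)

𝔽₂^ : ℕ → Set
𝔽₂^ k = Vec Bool k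

infixl 6 _⊕_
_⊕_ : ∀ {k} → 𝔽₂^ k → 𝔽₂^ k → 𝔽₂^ k
_⊕_ = zipWith _xor_

𝟎 : ∀ {k} → 𝔽₂^ k
𝟎 = replicate _ false

AtMostTwo : ∀ {A : Set} → (A → Set) → Set
AtMostTwo {A} S = ∀ (x y z : A) → S x → S y → S z → (x ≡ y) ⊎ (x ≡ z) ⊎ (y ≡ z)

APN : ∀ {k m} → (𝔽₂^ k → 𝔽₂^ m) → Set
APN {k} {m} F = ∀ (a : 𝔽₂^ k) → a ≢ 𝟎 → ∀ (b : 𝔽₂^ m) →
  AtMostTwo (λ x → F (x ⊕ a) ⊕ F x ≡ b)

-- An injective 𝔽₂-linear map (identifies 𝔽₂^k with a k-dimensional subspace).
record LinearEmbedding (k n : ℕ) : Set where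
  field
    map       : 𝔽₂^ k → 𝔽₂^ n
    additive  : ∀ x y → map (x ⊕ y) ≡ map x ⊕ map y
    injective : ∀ x y → map x ≡ map y → x ≡ y

{-# OPTIONS --safe #-}
module Submission where

-- Write H = ι(𝔽₂^k). As e₀ ∉ H, the map (t, u) ↦ ι u + t e₀ on 𝔽₂ × 𝔽₂^k is injective, hence onto
-- 𝔽₂^(k+1) by counting: every point lies in H or in H + e₀.
--
-- In a direction ι α ∈ H, the solutions of F(z + ι α) + F(z) = b in H are the images of the
-- solutions of f(x + α) + f(x) = b, and those in H + e₀ the images of the solutions of
-- g(y + α) + g(y) = b. Condition (2) says exactly that no b has solutions of both kinds; if it
-- failed, ι x, ι (x + α) and ι y + e₀ would be three solutions.
--
-- In a direction a = ι α + e₀ ∉ H, the solutions come in pairs {z, z + a} containing exactly one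
-- point ι r of H, at which F(ι r + a) + F(ι r) = g(r + α) + f(r). Two different such r, s would
-- violate (2) at x = s, y = s + α in direction r + s, so there is at most one pair.

open import Defs
open import Algebra.Bundles using (AbelianGroup)
open import Algebra.Structures using (IsAbelianGroup)
import Algebra.Properties.AbelianGroup as AbelianGroupProperties
import Algebra.Properties.CommutativeSemigroup as CommutativeSemigroupProperties
open import Data.Bool using (false; true) renaming (_≟_ to _≟ᵇ_)
open import Data.Bool.Properties using (xor-assoc; xor-comm; xor-identityˡ; xor-identityʳ; xor-same)
open import Data.Empty using (⊥; ⊥-elim)
open import Data.Fin using (Fin; zero; suc; punchOut)
open import Data.Fin.Properties using (any?; injective⇒≤; punchOut-injective; 2↔Bool; *↔×) renaming (_≟_ to _≟ᶠ_)
open import Data.Nat using (ℕ; zero; suc; _^_)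
open import Data.Nat.Properties using (1+n≰n)
open import Data.Product using (_×_; ∃; _,_; uncurry)
open import Data.Product.Function.NonDependent.Propositional using (_×-↔_; _×-⇔_)
open import Data.Sum using (_⊎_; inj₁; inj₂)
open import Data.Vec using ([]; _∷_; uncons)
open import Data.Vec.Properties using (≡-dec; zipWith-assoc; zipWith-comm; zipWith-identityˡ; zipWith-identityʳ)
open import Function using (id; _∘_)
open import Function.Bundles using (_⇔_; mk⇔; _↔_; mk↔ₛ′; Inverse; Injection; Equivalence)
open import Function.Construct.Composition using (_⇔-∘_)
open import Function.Construct.Identity using (⇔-id)
open import Function.Definitions using (Injective; StrictlySurjective)
open import Function.Properties.Inverse using (↔-sym; ↔-trans; ↔⇒↣)
open import Level using (0ℓ)
open import Relation.Binary.PropositionalEquality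
open import Relation.Nullary using (¬_; yes; no; contradiction)

⊕-self : ∀ {k} (x : 𝔽₂^ k) → x ⊕ x ≡ 𝟎
⊕-self []      = refl
⊕-self (b ∷ x) = cong₂ _∷_ (xor-same b) (⊕-self x)

⊕-isAbelianGroup : ∀ {k} → IsAbelianGroup _≡_ (_⊕_ {k}) 𝟎 id
⊕-isAbelianGroup = record
  { isGroup = record
    { isMonoid = record
      { isSemigroup = record
        { isMagma = record { isEquivalence = isEquivalence ; ∙-cong = cong₂ _⊕_ }
        ; assoc   = zipWith-assoc xor-assoc
        }
      ; identity = zipWith-identityˡ xor-identityˡ , zipWith-identityʳ xor-identityʳ
      }
    ; inverse = ⊕-self , ⊕-self
    ; ⁻¹-cong = cong id
    }
  ; comm = zipWith-comm xor-comm
  }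

⊕-abelianGroup : ℕ → AbelianGroup 0ℓ 0ℓ
⊕-abelianGroup k = record { isAbelianGroup = ⊕-isAbelianGroup {k} }

-- The inverse is id, so these laws are renamed after the forms they take definitionally.
module ⊕ {k : ℕ} where
  open AbelianGroup (⊕-abelianGroup k) public
    using (assoc; comm; identityˡ)
  open AbelianGroupProperties (⊕-abelianGroup k) public
    using (∙-cancelʳ; identityˡ-unique)
    renaming ( x∙y⁻¹≈ε⇒x≈y to x⊕y≡𝟎⇒x≡y; x≈y⇒x∙y⁻¹≈ε to x≡y⇒x⊕y≡𝟎; y≈x\\z to x⊕y≡z⇒y≡x⊕z
             ; identityʳ-unique to x⊕y≡x⇒y≡𝟎; \\-leftDividesˡ to x⊕[x⊕y]≡y; //-rightDividesʳ to [y⊕x]⊕x≡y)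
  open CommutativeSemigroupProperties (AbelianGroup.commutativeSemigroup (⊕-abelianGroup k)) public
    using (interchange; xy∙z≈xz∙y)

[x⊕y]⊕z≡𝟎⇔x≡y⊕z : ∀ {k} (x y z : 𝔽₂^ k) → x ⊕ y ⊕ z ≡ 𝟎 ⇔ x ≡ y ⊕ z
[x⊕y]⊕z≡𝟎⇔x≡y⊕z x y z = mk⇔
  (λ eq → ⊕.x⊕y≡𝟎⇒x≡y x (y ⊕ z) (trans (sym (⊕.assoc x y z)) eq))
  (λ eq → trans (⊕.assoc x y z) (⊕.x≡y⇒x⊕y≡𝟎 eq))

⊕-exchange : ∀ {k} {p q r s : 𝔽₂^ k} → p ⊕ q ≡ r ⊕ s → p ⊕ r ≡ q ⊕ s
⊕-exchange {p = p} {q} {r} {s} eq =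
  ⊕.x⊕y≡𝟎⇒x≡y (p ⊕ r) (q ⊕ s) (trans (sym (⊕.interchange p q r s)) (⊕.x≡y⇒x⊕y≡𝟎 eq))

fin-injective⇒strictlySurjective : ∀ {n} {h : Fin n → Fin n} →
  Injective _≡_ _≡_ h → StrictlySurjective _≡_ h
fin-injective⇒strictlySurjective {suc n} {h} h-inj v with any? (λ i → h i ≟ᶠ v)
... | yes hit = hit
... | no miss = contradiction (injective⇒≤ avoid-injective) 1+n≰n
  where
  avoids : ∀ i → v ≢ h i
  avoids i = miss ∘ (i ,_) ∘ sym
  avoid-injective : Injective _≡_ _≡_ (λ i → punchOut (avoids i))
  avoid-injective {i} {j} = h-inj ∘ punchOut-injective (avoids i) (avoids j)

injective⇒strictlySurjective : ∀ {A : Set} {n} → A ↔ Fin n →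
  {h : A → A} → Injective _≡_ _≡_ h → StrictlySurjective _≡_ h
injective⇒strictlySurjective A↔Fin {h} h-inj y =
  let i , eq = fin-injective⇒strictlySurjective conj-injective (to y) in from i , to-injective eq
  where
  open Inverse A↔Fin
  to-injective : Injective _≡_ _≡_ to
  to-injective = Injection.injective (↔⇒↣ A↔Fin)
  conj-injective : Injective _≡_ _≡_ (to ∘ h ∘ from)
  conj-injective {i} {j} eq =
    trans (sym (strictlyInverseˡ i)) (trans (cong to (h-inj (to-injective eq))) (strictlyInverseˡ j))

𝔽₂^↔Fin : ∀ k → 𝔽₂^ k ↔ Fin (2 ^ k)
𝔽₂^↔Fin zero    = mk↔ₛ′ (λ _ → zero) (λ _ → []) (λ { zero → refl ; (suc ()) }) (λ { [] → refl })
𝔽₂^↔Fin (suc k) = ↔-trans (mk↔ₛ′ uncons (uncurry _∷_) (λ _ → refl) (λ { (_ ∷ _) → refl }))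
                          (↔-trans (↔-sym 2↔Bool ×-↔ 𝔽₂^↔Fin k) (↔-sym *↔×))

module _ {A B : Set} where

  atMostTwo-injective : {S : A → Set} {T : B → Set} {p : B → A} → Injective _≡_ _≡_ p →
    (∀ {x} → T x → S (p x)) → AtMostTwo S → AtMostTwo T
  atMostTwo-injective p-inj T⊆S S≤2 x y z Tx Ty Tz with S≤2 _ _ _ (T⊆S Tx) (T⊆S Ty) (T⊆S Tz)
  ... | inj₁ px≡py        = inj₁ (p-inj px≡py)
  ... | inj₂ (inj₁ px≡pz) = inj₂ (inj₁ (p-inj px≡pz))
  ... | inj₂ (inj₂ py≡pz) = inj₂ (inj₂ (p-inj py≡pz))

  atMostTwo-image : {S : A → Set} {T : B → Set} (p : B → A) →
    (∀ {z} → S z → ∃ λ u → T u × z ≡ p u) → AtMostTwo T → AtMostTwo S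
  atMostTwo-image p S⊆pT T≤2 x y z Sx Sy Sz
    with u , Tu , refl ← S⊆pT Sx | v , Tv , refl ← S⊆pT Sy | w , Tw , refl ← S⊆pT Sz
    with T≤2 u v w Tu Tv Tw
  ... | inj₁ u≡v        = inj₁ (cong p u≡v)
  ... | inj₂ (inj₁ u≡w) = inj₂ (inj₁ (cong p u≡w))
  ... | inj₂ (inj₂ v≡w) = inj₂ (inj₂ (cong p v≡w))

atMostTwo-pair : ∀ {A : Set} {S : A → Set} (p q : A) → (∀ {z} → S z → z ≡ p ⊎ z ≡ q) → AtMostTwo S
atMostTwo-pair p q S⊆pq x y z Sx Sy Sz with S⊆pq Sx | S⊆pq Sy | S⊆pq Sz
... | inj₁ refl | inj₁ refl | _         = inj₁ refl
... | inj₂ refl | inj₂ refl | _         = inj₁ refl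
... | inj₁ refl | inj₂ refl | inj₁ refl = inj₂ (inj₁ refl)
... | inj₁ refl | inj₂ refl | inj₂ refl = inj₂ (inj₂ refl)
... | inj₂ refl | inj₁ refl | inj₁ refl = inj₂ (inj₂ refl)
... | inj₂ refl | inj₁ refl | inj₂ refl = inj₂ (inj₁ refl)

Δ : ∀ {k m} → (𝔽₂^ k → 𝔽₂^ m) → 𝔽₂^ k → 𝔽₂^ k → 𝔽₂^ m
Δ F a x = F (x ⊕ a) ⊕ F x

Δ-periodic : ∀ {k m} (F : 𝔽₂^ k → 𝔽₂^ m) a x → Δ F a (x ⊕ a) ≡ Δ F a x
Δ-periodic F a x = trans (cong (λ t → F t ⊕ F (x ⊕ a)) (⊕.[y⊕x]⊕x≡y a x)) (⊕.comm (F x) (F (x ⊕ a)))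

CrossCondition : ∀ {k m} (f g : 𝔽₂^ k → 𝔽₂^ m) → Set
CrossCondition f g = ∀ x y a → a ≢ 𝟎 → Δ f a x ≢ Δ g a y

crossCondition⇔ : ∀ {k m} (f g : 𝔽₂^ k → 𝔽₂^ m) → CrossCondition f g ⇔
  (∀ x y a → a ≢ 𝟎 → f (x ⊕ a) ⊕ f x ⊕ g (y ⊕ a) ⊕ g y ≢ 𝟎)
crossCondition⇔ f g = mk⇔
  (λ cross x y a a≢𝟎 → cross x y a a≢𝟎 ∘ Equivalence.to (sum≡𝟎⇔ x y a))
  (λ cross x y a a≢𝟎 → cross x y a a≢𝟎 ∘ Equivalence.from (sum≡𝟎⇔ x y a))
  where
  sum≡𝟎⇔ : ∀ x y a → f (x ⊕ a) ⊕ f x ⊕ g (y ⊕ a) ⊕ g y ≡ 𝟎 ⇔ Δ f a x ≡ Δ g a y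
  sum≡𝟎⇔ x y a = [x⊕y]⊕z≡𝟎⇔x≡y⊕z (Δ f a x) (g (y ⊕ a)) (g y)

module Embedding {k n : ℕ} (ι : LinearEmbedding k n) where
  open LinearEmbedding ι public renaming (map to φ)

  φ-injective : Injective _≡_ _≡_ φ
  φ-injective = injective _ _

  φ-𝟎 : φ 𝟎 ≡ 𝟎
  φ-𝟎 = ⊕.identityˡ-unique (φ 𝟎) (φ 𝟎) (trans (sym (additive 𝟎 𝟎)) (cong φ (⊕.identityˡ 𝟎)))

  φ-nonzero : ∀ {a} → a ≢ 𝟎 → φ a ≢ 𝟎
  φ-nonzero a≢𝟎 φa≡𝟎 = a≢𝟎 (φ-injective (trans φa≡𝟎 (sym φ-𝟎)))

  _∉H : 𝔽₂^ n → Set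
  c ∉H = ¬ ∃ λ u → φ u ≡ c

  φ≢φ⊕c : ∀ {c} → c ∉H → ∀ u v → φ u ≢ φ v ⊕ c
  φ≢φ⊕c c∉H u v eq = c∉H (v ⊕ u , trans (additive v u) (sym (⊕.x⊕y≡z⇒y≡x⊕z (φ v) _ (φ u) (sym eq))))

  φ⊕c-∉H : ∀ {c} → c ∉H → ∀ v → (φ v ⊕ c) ∉H
  φ⊕c-∉H c∉H v (u , eq) = φ≢φ⊕c c∉H u v eq

  module Restriction {m} (e : 𝔽₂^ n) (e∉H : e ∉H) (f g : 𝔽₂^ k → 𝔽₂^ m) (F : 𝔽₂^ n → 𝔽₂^ m)
    (F-on-H : ∀ x → F (φ x) ≡ f x) (F-on-H⊕e : ∀ x → F (φ x ⊕ e) ≡ g x) where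

    Δ-inH : ∀ a x → Δ F (φ a) (φ x) ≡ Δ f a x
    Δ-inH a x = cong₂ _⊕_ (trans (cong F (sym (additive x a))) (F-on-H (x ⊕ a))) (F-on-H x)

    Δ-inH⊕e : ∀ a x → Δ F (φ a) (φ x ⊕ e) ≡ Δ g a x
    Δ-inH⊕e a x = cong₂ _⊕_ (trans (cong F translate) (F-on-H⊕e (x ⊕ a))) (F-on-H⊕e x)
      where
      translate : φ x ⊕ e ⊕ φ a ≡ φ (x ⊕ a) ⊕ e
      translate = trans (⊕.xy∙z≈xz∙y (φ x) e (φ a)) (cong (_⊕ e) (sym (additive x a)))

    Δ-across : ∀ α r → Δ F (φ α ⊕ e) (φ r) ≡ g (r ⊕ α) ⊕ f r
    Δ-across α r = cong₂ _⊕_ (trans (cong F translate) (F-on-H⊕e (r ⊕ α))) (F-on-H r)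
      where
      translate : φ r ⊕ (φ α ⊕ e) ≡ φ (r ⊕ α) ⊕ e
      translate = trans (sym (⊕.assoc (φ r) (φ α) e)) (cong (_⊕ e) (sym (additive r α)))

    apn-f : APN F → APN f
    apn-f apn a a≢𝟎 b =
      atMostTwo-injective φ-injective (λ {x} → trans (Δ-inH a x)) (apn (φ a) (φ-nonzero a≢𝟎) b)

    apn-g : APN F → APN g
    apn-g apn a a≢𝟎 b =
      atMostTwo-injective (φ-injective ∘ ⊕.∙-cancelʳ e _ _) (λ {x} → trans (Δ-inH⊕e a x))
        (apn (φ a) (φ-nonzero a≢𝟎) b)

    crossCondition : APN F → CrossCondition f g
    crossCondition apn x y a a≢𝟎 Δf≡Δg
      with apn (φ a) (φ-nonzero a≢𝟎) (Δ f a x) (φ x) (φ (x ⊕ a)) (φ y ⊕ e)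
               (Δ-inH a x) (trans (Δ-inH a (x ⊕ a)) (Δ-periodic f a x)) (trans (Δ-inH⊕e a y) (sym Δf≡Δg))
    ... | inj₁ φx≡φ[x⊕a] = a≢𝟎 (⊕.x⊕y≡x⇒y≡𝟎 x a (sym (φ-injective φx≡φ[x⊕a])))
    ... | inj₂ (inj₁ eq) = φ≢φ⊕c e∉H x y eq
    ... | inj₂ (inj₂ eq) = φ≢φ⊕c e∉H (x ⊕ a) y eq

module Hyperplane {k : ℕ} (ι : LinearEmbedding k (suc k)) where
  open Embedding ι public

  extend : 𝔽₂^ (suc k) → 𝔽₂^ (suc k) → 𝔽₂^ (suc k)
  extend c (false ∷ u) = φ u
  extend c (true  ∷ u) = φ u ⊕ c

  extend-injective : ∀ {c} → c ∉H → Injective _≡_ _≡_ (extend c)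
  extend-injective c∉H {false ∷ u} {false ∷ v} eq = cong (false ∷_) (φ-injective eq)
  extend-injective c∉H {false ∷ u} {true  ∷ v} eq = contradiction eq (φ≢φ⊕c c∉H u v)
  extend-injective c∉H {true  ∷ u} {false ∷ v} eq = contradiction (sym eq) (φ≢φ⊕c c∉H v u)
  extend-injective c∉H {true  ∷ u} {true  ∷ v} eq = cong (true ∷_) (φ-injective (⊕.∙-cancelʳ _ _ _ eq))

  -- Opaque: otherwise each with-abstraction over split evaluates the search through Fin (2 ^ suc k).
  opaque
    extend-surjective : ∀ {c} → c ∉H → StrictlySurjective _≡_ (extend c)
    extend-surjective c∉H = injective⇒strictlySurjective (𝔽₂^↔Fin (suc k)) (extend-injective c∉H)

  data Split (c : 𝔽₂^ (suc k)) : 𝔽₂^ (suc k) → Set where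
    inH   : ∀ u → Split c (φ u)
    inH⊕c : ∀ u → Split c (φ u ⊕ c)

  split : ∀ {c} → c ∉H → ∀ z → Split c z
  split c∉H z with extend-surjective c∉H z
  ... | false ∷ u , refl = inH u
  ... | true  ∷ u , refl = inH⊕c u

  module Glue {m} (e : 𝔽₂^ (suc k)) (e∉H : e ∉H) (f g : 𝔽₂^ k → 𝔽₂^ m) (F : 𝔽₂^ (suc k) → 𝔽₂^ m)
    (F-on-H : ∀ x → F (φ x) ≡ f x) (F-on-H⊕e : ∀ x → F (φ x ⊕ e) ≡ g x) where
    open Restriction e e∉H f g F F-on-H F-on-H⊕e

    module _ (apn-f : APN f) (apn-g : APN g) (cross : CrossCondition f g) where

      ¬solutions-in-H-and-H⊕e : ∀ {α b u v} → α ≢ 𝟎 →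
        Δ F (φ α) (φ u) ≡ b → Δ F (φ α) (φ v ⊕ e) ≡ b → ⊥
      ¬solutions-in-H-and-H⊕e {α} {u = u} {v} α≢𝟎 sol-u sol-v =
        cross u v α α≢𝟎 (trans (sym (Δ-inH α u)) (trans sol-u (trans (sym sol-v) (Δ-inH⊕e α v))))

      apn-inH : ∀ α → α ≢ 𝟎 → ∀ b → AtMostTwo (λ z → Δ F (φ α) z ≡ b)
      apn-inH α α≢𝟎 b z₁ z₂ z₃ s₁ with split e∉H z₁
      ... | inH u₁   = atMostTwo-image φ onH (apn-f α α≢𝟎 b) (φ u₁) z₂ z₃ s₁
        where
        onH : ∀ {z} → Δ F (φ α) z ≡ b → ∃ λ u → Δ f α u ≡ b × z ≡ φ u
        onH {z} s with split e∉H z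
        ... | inH u   = u , trans (sym (Δ-inH α u)) s , refl
        ... | inH⊕c _ = ⊥-elim (¬solutions-in-H-and-H⊕e α≢𝟎 s₁ s)
      ... | inH⊕c v₁ = atMostTwo-image (λ v → φ v ⊕ e) onH⊕e (apn-g α α≢𝟎 b) (φ v₁ ⊕ e) z₂ z₃ s₁
        where
        onH⊕e : ∀ {z} → Δ F (φ α) z ≡ b → ∃ λ v → Δ g α v ≡ b × z ≡ φ v ⊕ e
        onH⊕e {z} s with split e∉H z
        ... | inH _   = ⊥-elim (¬solutions-in-H-and-H⊕e α≢𝟎 s s₁)
        ... | inH⊕c v = v , trans (sym (Δ-inH⊕e α v)) s , refl

      module _ (α : 𝔽₂^ k) (b : 𝔽₂^ m) where
        private
          a : 𝔽₂^ (suc k)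
          a = φ α ⊕ e

        solution-in-H-unique : ∀ {r s} → Δ F a (φ r) ≡ b → Δ F a (φ s) ≡ b → r ≡ s
        solution-in-H-unique {r} {s} sol-r sol-s with ≡-dec _≟ᵇ_ r s
        ... | yes r≡s = r≡s
        ... | no  r≢s = ⊥-elim (cross s (s ⊕ α) (s ⊕ r) (r≢s ∘ sym ∘ ⊕.x⊕y≡𝟎⇒x≡y s r) Δf≡Δg)
          where
          open ≡-Reasoning
          Δf≡Δg : Δ f (s ⊕ r) s ≡ Δ g (s ⊕ r) (s ⊕ α)
          Δf≡Δg = begin
            f (s ⊕ (s ⊕ r)) ⊕ f s           ≡⟨ cong (λ t → f t ⊕ f s) (⊕.x⊕[x⊕y]≡y s r) ⟩
            f r ⊕ f s                       ≡⟨ ⊕-exchange (trans (across sol-r) (sym (across sol-s))) ⟨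
            g (r ⊕ α) ⊕ g (s ⊕ α)           ≡⟨ cong (λ t → g t ⊕ g (s ⊕ α)) shift ⟨
            g (s ⊕ α ⊕ (s ⊕ r)) ⊕ g (s ⊕ α) ∎
            where
            across : ∀ {t} → Δ F a (φ t) ≡ b → g (t ⊕ α) ⊕ f t ≡ b
            across {t} = trans (sym (Δ-across α t))
            shift : s ⊕ α ⊕ (s ⊕ r) ≡ r ⊕ α
            shift = trans (⊕.xy∙z≈xz∙y s α (s ⊕ r)) (cong (_⊕ α) (⊕.x⊕[x⊕y]≡y s r))

        solution⇒pair : ∀ {z} → Δ F a z ≡ b → ∃ λ r → Δ F a (φ r) ≡ b × (z ≡ φ r ⊎ z ≡ φ r ⊕ a)
        solution⇒pair {z} sol with split (φ⊕c-∉H e∉H α) z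
        ... | inH r   = r , sol , inj₁ refl
        ... | inH⊕c r = r , trans (sym (Δ-periodic F a (φ r))) sol , inj₂ refl

        apn-inH⊕e : AtMostTwo (λ z → Δ F a z ≡ b)
        apn-inH⊕e z₁ z₂ z₃ s₁ with r₁ , sol-r₁ , _ ← solution⇒pair s₁ =
          atMostTwo-pair (φ r₁) (φ r₁ ⊕ a) onPair z₁ z₂ z₃ s₁
          where
          onPair : ∀ {z} → Δ F a z ≡ b → z ≡ φ r₁ ⊎ z ≡ φ r₁ ⊕ a
          onPair s with r , sol-r , z∈pair ← solution⇒pair s
            rewrite solution-in-H-unique sol-r sol-r₁ = z∈pair

      apn-F : APN F
      apn-F a a≢𝟎 b with split e∉H a
      ... | inH α   = apn-inH α (λ α≡𝟎 → a≢𝟎 (trans (cong φ α≡𝟎) φ-𝟎)) b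
      ... | inH⊕c α = apn-inH⊕e α b

    apn⇔ : APN F ⇔ (APN f × APN g × CrossCondition f g)
    apn⇔ = mk⇔ (λ apn → apn-f apn , apn-g apn , crossCondition apn)
               (λ (apn-f , apn-g , cross) → apn-F apn-f apn-g cross)

theorem1 : ∀ (k m : ℕ) (ι : LinearEmbedding k (suc k)) (e₀ : 𝔽₂^ (suc k))
    → ¬ (∃ λ x → LinearEmbedding.map ι x ≡ e₀)
    → (f g : 𝔽₂^ k → 𝔽₂^ m) (F : 𝔽₂^ (suc k) → 𝔽₂^ m)
    → (∀ x → F (LinearEmbedding.map ι x) ≡ f x)
    → (∀ x → F (LinearEmbedding.map ι x ⊕ e₀) ≡ g x)
    → APN F ⇔ (APN f × APN g
               × (∀ (x y a : 𝔽₂^ k) → a ≢ 𝟎 → f (x ⊕ a) ⊕ f x ⊕ g (y ⊕ a) ⊕ g y ≢ 𝟎))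
theorem1 k m ι e₀ e₀∉H f g F F-on-H F-on-H⊕e₀ =
  (⇔-id _ ×-⇔ ⇔-id _ ×-⇔ crossCondition⇔ f g)
    ⇔-∘ Hyperplane.Glue.apn⇔ ι e₀ e₀∉H f g F F-on-H F-on-H⊕e₀
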